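{- Let $(F_n)_{n\in\mathbb Z}$ be the extended Fibonacci sequence. For every integer $n$: (B) the point $\left(\frac{F_{2n+2}}{F_{2n+1}},\frac{1}{F_{2n+1}}\right)$ lies on the circle of radius $\sqrt5/2$ centered at $\left(\tfrac12,0\right)$; (C) the point $\left(\frac{F_{2n+3}}{F_{2n+1}},\frac{1}{F_{2n+1}}\right)$ lies on the circle of radius $\sqrt5/2$ centered at $\left(\tfrac32,0\right)$; (D) the point $\left(\frac{ -F_{2n-1}}{F_{2n+1}},\frac{1}{F_{2n+1}}\right)$ lies on the circle of radius $\sqrt5/2$ centered at $\left(-\tfrac32,0\right)$. Each of these points is a point of tangency of two Ford circles. Together with the circle of radius $\sqrt5/2$ centered at $\left(-\tfrac12,0\right)$ (which contains the points $\left(\frac{F_{2n}}{F_{2n+1}},\frac{1}{F_{2n+1}}\right)$), these circles meet the $x$-axis at the golden-ratio values: the circle centered at $-\tfrac12$ at $-\varphi$ and $\tau$; the one centered at $\tfrac12$ at $-\tau$ and $\varphi$; the one centered at $\tfrac32$ at $\tau^2$ and $\varphi^2$; the one centered at $-\tfrac32$ at $-\varphi^2$ and $-\tau^2$; where $\varphi=\frac{\sqrt5+1}{2}$ and $\tau=\frac{\sqrt5-1}{2}$.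
   Context: The extended Fibonacci sequence is the bilateral sequence $(F_n)_{n\in\mathbb Z}$ defined by $F_0=0$, $F_1=1$, and $F_{n+1}=F_n+F_{n-1}$ for all $n\in\mathbb Z$. For integers $p$ and $m\neq0$, the Ford circle $K[p,m]$ is the circle of radius $\frac{1}{2m^2}$ in the upper half-plane tangent to the $x$-axis at $x=\frac{p}{m}$. By convention the horizontal line $y=1$ is also counted among the Ford circles, as the Ford circle over the point at infinity $x=\frac10$. -}

module Defs where

open import Data.Nat using (ℕ; zero; suc)
open import Data.Integer as ℤ using (ℤ; +_; -[1+_])
open import Data.Rational as ℚ using (ℚ; 0ℚ; 1ℚ; _+_; _-_; _*_; -_; 1/_; ≢-nonZero)
open import Data.Rational.Properties using (_≟_)
open import Data.Product using (_×_; _,_; proj₁; proj₂)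
open import Data.Empty using (⊥)
open import Relation.Nullary using (yes; no)
open import Relation.Binary.PropositionalEquality using (_≡_; _≢_)

-- fwd k = (F_k , F_{k+1})
fwd : ℕ → ℤ × ℤ
fwd zero    = (+ 0 , + 1)
fwd (suc k) = (proj₂ (fwd k) , proj₁ (fwd k) ℤ.+ proj₂ (fwd k))

-- bwd k = (F_{-k} , F_{-k+1});  F_{-k-1} = F_{-k+1} - F_{-k}
bwd : ℕ → ℤ × ℤ
bwd zero    = (+ 0 , + 1)
bwd (suc k) = (proj₂ (bwd k) ℤ.- proj₁ (bwd k) , proj₁ (bwd k))

F : ℤ → ℤ
F (+ n)      = proj₁ (fwd n)
F -[1+ n ]   = proj₁ (bwd (suc n))

-- Rationals: embedding of ℤ and a total inverse / division
-- (x / 0 := 0; only ever applied to nonzero denominators here).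

⟦_⟧ : ℤ → ℚ
⟦ z ⟧ = z ℚ./ 1

inv : ℚ → ℚ
inv q with q ≟ 0ℚ
... | yes _ = 0ℚ
... | no ne = 1/_ q {{≢-nonZero ne}}

_÷_ : ℚ → ℚ → ℚ
p ÷ q = p * inv q

half : ℚ
half = inv (⟦ + 2 ⟧)

-- The field ℚ(√5): elements a + b√5 with a b : ℚ.

record ℚ√5 : Set where
  constructor ⟨_,_⟩
  field
    re : ℚ
    im : ℚ
open ℚ√5 public

infixl 6 _⊕_ _⊖_
infixl 7 _⊗_

_⊕_ : ℚ√5 → ℚ√5 → ℚ√5
⟨ a , b ⟩ ⊕ ⟨ c , d ⟩ = ⟨ a + c , b + d ⟩

_⊖_ : ℚ√5 → ℚ√5 → ℚ√5
⟨ a , b ⟩ ⊖ ⟨ c , d ⟩ = ⟨ a - c , b - d ⟩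

_⊗_ : ℚ√5 → ℚ√5 → ℚ√5
⟨ a , b ⟩ ⊗ ⟨ c , d ⟩ = ⟨ a * c + ⟦ + 5 ⟧ * (b * d) , a * d + b * c ⟩

↑ : ℚ → ℚ√5
↑ q = ⟨ q , 0ℚ ⟩

√5 : ℚ√5
√5 = ⟨ 0ℚ , 1ℚ ⟩

φ : ℚ√5
φ = ⟨ half , half ⟩

τ : ℚ√5
τ = ⟨ - half , half ⟩

ρ : ℚ√5
ρ = ⟨ 0ℚ , half ⟩

OnCircle : (cx cy : ℚ) (r : ℚ√5) (x y : ℚ√5) → Set
OnCircle cx cy r x y =
  (x ⊖ ↑ cx) ⊗ (x ⊖ ↑ cx) ⊕ (y ⊖ ↑ cy) ⊗ (y ⊖ ↑ cy) ≡ r ⊗ r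

-- Ford circles.  K[p,m] (m ≠ 0): radius 1/(2m²), tangent to the x-axis
-- at p/m.  ∞ : the horizontal line y = 1 (Ford circle over 1/0).

data Ford : Set where
  K : (p m : ℤ) → m ≢ + 0 → Ford
  ∞ : Ford

Point : Set
Point = ℚ × ℚ

radius : (m : ℤ) → ℚ
radius m = inv (⟦ + 2 ⟧ * (⟦ m ⟧ * ⟦ m ⟧))

sq : ℚ → ℚ
sq x = x * x

OnFord : Ford → Point → Set
OnFord (K p m _) (x , y) =
  sq (x - ⟦ p ⟧ ÷ ⟦ m ⟧) + sq (y - radius m) ≡ sq (radius m)
OnFord ∞ (x , y) = y ≡ 1ℚ

-- the two Ford circles are tangent (Ford circles never overlap, so
-- tangency is external: distance of centres = sum of radii; a circle is
-- tangent to the line y = 1 iff its centre is at distance r from it)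
Tangent : Ford → Ford → Set
Tangent (K p m _) (K q k _) =
  sq (⟦ p ⟧ ÷ ⟦ m ⟧ - ⟦ q ⟧ ÷ ⟦ k ⟧) + sq (radius m - radius k)
    ≡ sq (radius m + radius k)
Tangent (K p m _) ∞ = 1ℚ - radius m ≡ radius m
Tangent ∞ (K q k _) = 1ℚ - radius k ≡ radius k
Tangent ∞ ∞ = ⊥

IsTangencyPoint : Ford → Ford → Point → Set
IsTangencyPoint C₁ C₂ P = Tangent C₁ C₂ × OnFord C₁ P × OnFord C₂ P

FordTangencyPoint : Point → Set
FordTangencyPoint P = Σ Ford λ C₁ → Σ Ford λ C₂ → IsTangencyPoint C₁ C₂ P
  where open import Data.Product using (Σ)

{-# OPTIONS --safe #-}
module Submission where

open import Defs
open import Data.Integer using (ℤ; +_; -[1+_]) renaming (_+_ to _+ℤ_; _*_ to _*ℤ_; _-_ to _-ℤ_)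
open import Data.Rational using (ℚ; 0ℚ; 1ℚ; -_; _*_)
open import Data.Product using (_×_; _,_)
open import Relation.Binary.PropositionalEquality using (_≢_)

open import Level using (0ℓ)
open import Function using (id)
open import Data.Nat as ℕ using (zero; suc)
import Data.Nat.Properties as ℕ
import Data.Nat.Coprimality as Coprimality
open import Data.Integer as ℤ using (0ℤ; 1ℤ; -1ℤ; ∣_∣) renaming (-_ to -ℤ_)
import Data.Integer.Properties as ℤ
open import Data.Integer.Tactic.RingSolver using (solve-∀)
open import Data.Rational using (mkℚ; _+_; _-_; toℚᵘ; ≢-nonZero)
open import Data.Rational.Properties
  using (_≟_; +-*-commutativeRing; normalize-coprime; toℚᵘ-injective; toℚᵘ-homo-+; toℚᵘ-homo-*; toℚᵘ-homo‿-;
         *-identityˡ; *-identityʳ; *-assoc; *-comm; *-zeroˡ; *-inverseʳ; neg-distribˡ-*)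
open import Data.Rational.Unnormalised as ℚᵘ using (*≡*) renaming (_≃_ to _≃ᵘ_)
import Data.Rational.Unnormalised.Properties as ℚᵘ
open import Data.List using (_∷_; [])
open import Data.Product using (proj₁; proj₂)
open import Data.Sum using (_⊎_; inj₁; inj₂; [_,_]′)
open import Relation.Nullary using (yes; no; contradiction)
open import Relation.Nullary.Decidable using (dec⇒maybe)
open import Relation.Binary.PropositionalEquality
import Tactic.RingSolver as RingSolver
open import Tactic.RingSolver using (solve)
open import Tactic.RingSolver.Core.AlmostCommutativeRing using (AlmostCommutativeRing; fromCommutativeRing)
open ≡-Reasoning

-- Write a = F₂ₙ and b = F₂ₙ₊₁. Cassini's identity at the even index 2n reads b² − ab − a² = 1;
-- divided by b² it says that s = a/b and y = 1/b satisfy (s + 1/2)² + y² = 5/4, so the point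
-- (s + k, y) lies on the circle of radius √5/2 centred at (k − 1/2, 0).
--
-- For the Ford circles, the doubling formulas F₂ₙ = Fₙ(2Fₙ₊₁ − Fₙ), F₂ₙ₊₁ = Fₙ² + Fₙ₊₁² write the
-- point as ((pq + rs)/(q² + s²), 1/(q² + s²)) with q = Fₙ, s = Fₙ₊₁ and ps − rq = ±1 (Cassini at n),
-- which is exactly the point where K[p,q] and K[r,s] touch. If Fₙ or Fₙ₊₁ vanishes then b = 1 and
-- the point is where K[a + kb, 1] touches the line y = 1. The x-axis intersections are computations
-- in ℚ(√5).

-- Fibonacci identities

F-rec : ∀ m → F (m +ℤ + 2) ≡ F (m +ℤ + 1) +ℤ F m
F-rec (+ k) rewrite ℕ.+-comm k 2 | ℕ.+-comm k 1 = ℤ.+-comm (proj₁ (fwd k)) (proj₂ (fwd k))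
F-rec -[1+ 0 ] = refl
F-rec -[1+ 1 ] = refl
F-rec -[1+ suc (suc j) ] = x≡y+[x-y] (proj₁ (bwd (suc j))) (proj₁ (bwd (suc (suc j))))
  where
  x≡y+[x-y] : ∀ x y → x ≡ y +ℤ (x -ℤ y)
  x≡y+[x-y] = solve-∀

ℤ-bi-induction : (P : ℤ → Set) → P 0ℤ → (∀ n → P n → P (n +ℤ 1ℤ)) → (∀ n → P (n +ℤ 1ℤ) → P n) → ∀ n → P n
ℤ-bi-induction P base up down (+ zero) = base
ℤ-bi-induction P base up down (+ suc k) =
  subst P (cong +_ (ℕ.+-comm k 1)) (up (+ k) (ℤ-bi-induction P base up down (+ k)))
ℤ-bi-induction P base up down -[1+ zero ] = down -[1+ zero ] base
ℤ-bi-induction P base up down -[1+ suc k ] = down -[1+ suc k ] (ℤ-bi-induction P base up down -[1+ k ])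

F-rec-suc : ∀ n → F (n +ℤ 1ℤ +ℤ 1ℤ) ≡ F (n +ℤ 1ℤ) +ℤ F n
F-rec-suc n = trans (cong F (ℤ.+-assoc n 1ℤ 1ℤ)) (F-rec n)

F-rec-pred : ∀ m → F (m -ℤ 1ℤ) ≡ F (m +ℤ 1ℤ) -ℤ F m
F-rec-pred m = begin
  F (m -ℤ 1ℤ)                                          ≡⟨ x≡y+x-y (F (m -ℤ 1ℤ)) (F (m -ℤ 1ℤ +ℤ 1ℤ)) ⟩
  F (m -ℤ 1ℤ +ℤ 1ℤ) +ℤ F (m -ℤ 1ℤ) -ℤ F (m -ℤ 1ℤ +ℤ 1ℤ) ≡⟨ cong₂ _-ℤ_ (sym (F-rec (m -ℤ 1ℤ))) (cong F (index₁ m)) ⟩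
  F (m -ℤ 1ℤ +ℤ + 2) -ℤ F m                            ≡⟨ cong (λ i → F i -ℤ F m) (index₂ m) ⟩
  F (m +ℤ 1ℤ) -ℤ F m                                   ∎
  where
  x≡y+x-y : ∀ x y → x ≡ y +ℤ x -ℤ y
  x≡y+x-y = solve-∀
  index₁ : ∀ m → m -ℤ 1ℤ +ℤ 1ℤ ≡ m
  index₁ = solve-∀
  index₂ : ∀ m → m -ℤ 1ℤ +ℤ + 2 ≡ m +ℤ 1ℤ
  index₂ = solve-∀

F-rec-3 : ∀ m → F (m +ℤ + 3) ≡ F (m +ℤ + 2) +ℤ F (m +ℤ 1ℤ)
F-rec-3 m = begin
  F (m +ℤ + 3)                        ≡⟨ cong F (index₁ m) ⟩
  F (m +ℤ 1ℤ +ℤ + 2)                  ≡⟨ F-rec (m +ℤ 1ℤ) ⟩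
  F (m +ℤ 1ℤ +ℤ 1ℤ) +ℤ F (m +ℤ 1ℤ)    ≡⟨ cong (λ i → F i +ℤ F (m +ℤ 1ℤ)) (index₂ m) ⟩
  F (m +ℤ + 2) +ℤ F (m +ℤ 1ℤ)         ∎
  where
  index₁ : ∀ m → m +ℤ + 3 ≡ m +ℤ 1ℤ +ℤ + 2
  index₁ = solve-∀
  index₂ : ∀ m → m +ℤ 1ℤ +ℤ 1ℤ ≡ m +ℤ + 2
  index₂ = solve-∀

cassiniForm : ℤ → ℤ → ℤ
cassiniForm u v = v *ℤ v -ℤ u *ℤ v -ℤ u *ℤ u

cassiniForm-step : ∀ u v → cassiniForm v (v +ℤ u) ≡ -ℤ cassiniForm u v
cassiniForm-step = identity
  where
  identity : ∀ u v → (v +ℤ u) *ℤ (v +ℤ u) -ℤ v *ℤ (v +ℤ u) -ℤ v *ℤ v ≡ -ℤ (v *ℤ v -ℤ u *ℤ v -ℤ u *ℤ u)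
  identity = solve-∀

cassiniForm-doubling : ∀ u v →
  cassiniForm (u *ℤ (+ 2 *ℤ v -ℤ u)) (u *ℤ u +ℤ v *ℤ v) ≡ cassiniForm u v *ℤ cassiniForm u v
cassiniForm-doubling = identity
  where
  identity : ∀ u v →
    (u *ℤ u +ℤ v *ℤ v) *ℤ (u *ℤ u +ℤ v *ℤ v) -ℤ u *ℤ (+ 2 *ℤ v -ℤ u) *ℤ (u *ℤ u +ℤ v *ℤ v)
      -ℤ u *ℤ (+ 2 *ℤ v -ℤ u) *ℤ (u *ℤ (+ 2 *ℤ v -ℤ u))
    ≡ (v *ℤ v -ℤ u *ℤ v -ℤ u *ℤ u) *ℤ (v *ℤ v -ℤ u *ℤ v -ℤ u *ℤ u)
  identity = solve-∀

square-≡-neg : ∀ {x y} → x ≡ -ℤ y → x *ℤ x ≡ y *ℤ y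
square-≡-neg {y = y} refl = identity y
  where
  identity : ∀ y → (-ℤ y) *ℤ (-ℤ y) ≡ y *ℤ y
  identity = solve-∀

cassiniAt : ℤ → ℤ
cassiniAt n = cassiniForm (F n) (F (n +ℤ 1ℤ))

cassiniAt-suc : ∀ n → cassiniAt (n +ℤ 1ℤ) ≡ -ℤ cassiniAt n
cassiniAt-suc n = trans (cong (cassiniForm (F (n +ℤ 1ℤ))) (F-rec-suc n)) (cassiniForm-step (F n) (F (n +ℤ 1ℤ)))

cassiniAt² : ∀ n → cassiniAt n *ℤ cassiniAt n ≡ 1ℤ
cassiniAt² = ℤ-bi-induction (λ n → cassiniAt n *ℤ cassiniAt n ≡ 1ℤ) refl
  (λ n h → trans (square-≡-neg (cassiniAt-suc n)) h)
  (λ n h → trans (sym (square-≡-neg (cassiniAt-suc n))) h)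

consecutive : ℤ → ℤ × ℤ
consecutive m = F m , F (m +ℤ 1ℤ)

fibStep : ℤ × ℤ → ℤ × ℤ
fibStep (x , y) = y , y +ℤ x

fibStep-injective : ∀ {p q} → fibStep p ≡ fibStep q → p ≡ q
fibStep-injective {p} {q} eq = begin
  p                   ≡⟨ unstep-fibStep p ⟨
  unstep (fibStep p)  ≡⟨ cong unstep eq ⟩
  unstep (fibStep q)  ≡⟨ unstep-fibStep q ⟩
  q                   ∎
  where
  unstep : ℤ × ℤ → ℤ × ℤ
  unstep (y , z) = z -ℤ y , y
  y+x-y≡x : ∀ x y → y +ℤ x -ℤ y ≡ x
  y+x-y≡x = solve-∀
  unstep-fibStep : ∀ p → unstep (fibStep p) ≡ p
  unstep-fibStep (x , y) = cong (_, y) (y+x-y≡x x y)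

consecutive-suc : ∀ m → consecutive (m +ℤ 1ℤ) ≡ fibStep (consecutive m)
consecutive-suc m = cong (F (m +ℤ 1ℤ) ,_) (F-rec-suc m)

doubling : ℤ × ℤ → ℤ × ℤ
doubling (u , v) = u *ℤ (+ 2 *ℤ v -ℤ u) , u *ℤ u +ℤ v *ℤ v

doubling-fibStep : ∀ p → doubling (fibStep p) ≡ fibStep (fibStep (doubling p))
doubling-fibStep (u , v) = cong₂ _,_ (even u v) (odd u v)
  where
  even : ∀ u v → v *ℤ (+ 2 *ℤ (v +ℤ u) -ℤ v) ≡ u *ℤ u +ℤ v *ℤ v +ℤ u *ℤ (+ 2 *ℤ v -ℤ u)
  even = solve-∀
  odd : ∀ u v → v *ℤ v +ℤ (v +ℤ u) *ℤ (v +ℤ u)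
              ≡ u *ℤ u +ℤ v *ℤ v +ℤ u *ℤ (+ 2 *ℤ v -ℤ u) +ℤ (u *ℤ u +ℤ v *ℤ v)
  odd = solve-∀

-- When n increases by one, both sides are transformed by fibStep twice, and fibStep is injective.
F-doubling : ∀ n → consecutive (+ 2 *ℤ n) ≡ doubling (consecutive n)
F-doubling = ℤ-bi-induction (λ n → consecutive (+ 2 *ℤ n) ≡ doubling (consecutive n)) refl up down
  where
  twice-suc : ∀ n → consecutive (+ 2 *ℤ (n +ℤ 1ℤ)) ≡ fibStep (fibStep (consecutive (+ 2 *ℤ n)))
  twice-suc n = begin
    consecutive (+ 2 *ℤ (n +ℤ 1ℤ))                ≡⟨ cong consecutive (index n) ⟩
    consecutive (+ 2 *ℤ n +ℤ 1ℤ +ℤ 1ℤ)             ≡⟨ consecutive-suc (+ 2 *ℤ n +ℤ 1ℤ) ⟩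
    fibStep (consecutive (+ 2 *ℤ n +ℤ 1ℤ))         ≡⟨ cong fibStep (consecutive-suc (+ 2 *ℤ n)) ⟩
    fibStep (fibStep (consecutive (+ 2 *ℤ n)))     ∎
    where
    index : ∀ n → + 2 *ℤ (n +ℤ 1ℤ) ≡ + 2 *ℤ n +ℤ 1ℤ +ℤ 1ℤ
    index = solve-∀
  doubling-suc : ∀ n → doubling (consecutive (n +ℤ 1ℤ)) ≡ fibStep (fibStep (doubling (consecutive n)))
  doubling-suc n = trans (cong doubling (consecutive-suc n)) (doubling-fibStep (consecutive n))
  up : ∀ n → consecutive (+ 2 *ℤ n) ≡ doubling (consecutive n)
           → consecutive (+ 2 *ℤ (n +ℤ 1ℤ)) ≡ doubling (consecutive (n +ℤ 1ℤ))
  up n h = trans (twice-suc n) (trans (cong (λ p → fibStep (fibStep p)) h) (sym (doubling-suc n)))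
  down : ∀ n → consecutive (+ 2 *ℤ (n +ℤ 1ℤ)) ≡ doubling (consecutive (n +ℤ 1ℤ))
             → consecutive (+ 2 *ℤ n) ≡ doubling (consecutive n)
  down n h = fibStep-injective (fibStep-injective (trans (sym (twice-suc n)) (trans h (doubling-suc n))))

cassiniAt-even : ∀ n → cassiniAt (+ 2 *ℤ n) ≡ 1ℤ
cassiniAt-even n = begin
  cassiniAt (+ 2 *ℤ n)                               ≡⟨ cong (λ p → cassiniForm (proj₁ p) (proj₂ p)) (F-doubling n) ⟩
  cassiniForm (proj₁ (doubling (consecutive n))) (proj₂ (doubling (consecutive n)))
                                                     ≡⟨ cassiniForm-doubling (F n) (F (n +ℤ 1ℤ)) ⟩
  cassiniAt n *ℤ cassiniAt n                         ≡⟨ cassiniAt² n ⟩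
  1ℤ                                                 ∎

square≡+∣∣*∣∣ : ∀ x → x *ℤ x ≡ + (∣ x ∣ ℕ.* ∣ x ∣)
square≡+∣∣*∣∣ (+ n)    = sym (ℤ.pos-* n n)
square≡+∣∣*∣∣ -[1+ n ] = refl

neg-square≢1 : ∀ x → -ℤ (x *ℤ x) ≢ 1ℤ
neg-square≢1 x rewrite square≡+∣∣*∣∣ x with ∣ x ∣ ℕ.* ∣ x ∣
... | zero  = λ ()
... | suc _ = λ ()

square²≡1⇒square≡1 : ∀ x → (x *ℤ x) *ℤ (x *ℤ x) ≡ 1ℤ → x *ℤ x ≡ 1ℤ
square²≡1⇒square≡1 x h = trans (square≡+∣∣*∣∣ x) (cong +_ (ℕ.m*n≡1⇒m≡1 m m m*m≡1))
  where
  m = ∣ x ∣ ℕ.* ∣ x ∣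
  m*m≡1 : m ℕ.* m ≡ 1
  m*m≡1 = ℤ.+-injective (trans (ℤ.pos-* m m) (trans (cong (λ y → y *ℤ y) (sym (square≡+∣∣*∣∣ x))) h))

sumOfSquares≢0 : ∀ q s → q ≢ 0ℤ → q *ℤ q +ℤ s *ℤ s ≢ 0ℤ
sumOfSquares≢0 q s q≢0 eq = q≢0 (ℤ.∣i∣≡0⇒i≡0 ([ id , id ]′ (ℕ.m*n≡0⇒m≡0∨n≡0 ∣ q ∣ ∣q∣²≡0)))
  where
  ∣q∣²≡0 : ∣ q ∣ ℕ.* ∣ q ∣ ≡ 0
  ∣q∣²≡0 = ℕ.m+n≡0⇒m≡0 _ (ℤ.+-injective (trans (sym (cong₂ _+ℤ_ (square≡+∣∣*∣∣ q) (square≡+∣∣*∣∣ s))) eq))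

cassiniForm-0ˡ : ∀ v → cassiniForm 0ℤ v ≡ v *ℤ v
cassiniForm-0ˡ = identity
  where
  identity : ∀ v → v *ℤ v -ℤ 0ℤ *ℤ v -ℤ 0ℤ *ℤ 0ℤ ≡ v *ℤ v
  identity = solve-∀

cassiniForm-0ʳ : ∀ u → cassiniForm u 0ℤ ≡ -ℤ (u *ℤ u)
cassiniForm-0ʳ = identity
  where
  identity : ∀ u → 0ℤ *ℤ 0ℤ -ℤ u *ℤ 0ℤ -ℤ u *ℤ u ≡ -ℤ (u *ℤ u)
  identity = solve-∀

sumOfSquares≡1 : ∀ u v → u ≡ 0ℤ ⊎ v ≡ 0ℤ → cassiniForm u v *ℤ cassiniForm u v ≡ 1ℤ → u *ℤ u +ℤ v *ℤ v ≡ 1ℤ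
sumOfSquares≡1 u v (inj₁ refl) h =
  trans (0²+v²≡v² v) (square²≡1⇒square≡1 v (trans (cong (λ c → c *ℤ c) (sym (cassiniForm-0ˡ v))) h))
  where
  0²+v²≡v² : ∀ v → 0ℤ *ℤ 0ℤ +ℤ v *ℤ v ≡ v *ℤ v
  0²+v²≡v² = solve-∀
sumOfSquares≡1 u v (inj₂ refl) h =
  trans (u²+0²≡u² u) (square²≡1⇒square≡1 u (trans (sym (square-≡-neg (cassiniForm-0ʳ u))) h))
  where
  u²+0²≡u² : ∀ u → u *ℤ u +ℤ 0ℤ *ℤ 0ℤ ≡ u *ℤ u
  u²+0²≡u² = solve-∀

-- Rational arithmetic

-- The reflective solver treats every subterm that is not a bound variable as a constant, so the
-- identities it proves below are stated over variables, with definitions unfolded.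
ℚ-ring : AlmostCommutativeRing 0ℓ 0ℓ
ℚ-ring = fromCommutativeRing +-*-commutativeRing (λ q → dec⇒maybe (0ℚ ≟ q))

-- An identity holding modulo the relation x = y, certified by exhibiting the difference of the two
-- sides as a multiple of x − y; nested uses give certificates modulo several relations.
≡-modulo : ∀ {lhs rhs} c {x y} → x ≡ y → lhs ≡ rhs + c * (x - y) → lhs ≡ rhs
≡-modulo {lhs} {rhs} c {x} refl eq = trans eq (solve (rhs ∷ c ∷ x ∷ []) ℚ-ring)

⟦⟧≡mkℚ : ∀ z → ⟦ z ⟧ ≡ mkℚ z 0 (Coprimality.sym (Coprimality.1-coprimeTo ∣ z ∣))
⟦⟧≡mkℚ (+ n)    = normalize-coprime (Coprimality.sym (Coprimality.1-coprimeTo n))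
⟦⟧≡mkℚ -[1+ n ] = cong -_ (normalize-coprime (Coprimality.sym (Coprimality.1-coprimeTo (suc n))))

⟦⟧-homo-+ : ∀ x y → ⟦ x +ℤ y ⟧ ≡ ⟦ x ⟧ + ⟦ y ⟧
⟦⟧-homo-+ x y = toℚᵘ-injective (ℚᵘ.≃-trans unnormalised (ℚᵘ.≃-sym (toℚᵘ-homo-+ ⟦ x ⟧ ⟦ y ⟧)))
  where
  identity : ∀ x y → (x +ℤ y) *ℤ 1ℤ ≡ (x *ℤ 1ℤ +ℤ y *ℤ 1ℤ) *ℤ 1ℤ
  identity = solve-∀
  unnormalised : toℚᵘ ⟦ x +ℤ y ⟧ ≃ᵘ toℚᵘ ⟦ x ⟧ ℚᵘ.+ toℚᵘ ⟦ y ⟧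
  unnormalised rewrite ⟦⟧≡mkℚ (x +ℤ y) | ⟦⟧≡mkℚ x | ⟦⟧≡mkℚ y = *≡* (identity x y)

⟦⟧-homo-* : ∀ x y → ⟦ x *ℤ y ⟧ ≡ ⟦ x ⟧ * ⟦ y ⟧
⟦⟧-homo-* x y = toℚᵘ-injective (ℚᵘ.≃-trans unnormalised (ℚᵘ.≃-sym (toℚᵘ-homo-* ⟦ x ⟧ ⟦ y ⟧)))
  where
  unnormalised : toℚᵘ ⟦ x *ℤ y ⟧ ≃ᵘ toℚᵘ ⟦ x ⟧ ℚᵘ.* toℚᵘ ⟦ y ⟧
  unnormalised rewrite ⟦⟧≡mkℚ (x *ℤ y) | ⟦⟧≡mkℚ x | ⟦⟧≡mkℚ y = *≡* refl

⟦⟧-homo-neg : ∀ x → ⟦ -ℤ x ⟧ ≡ - ⟦ x ⟧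
⟦⟧-homo-neg x = toℚᵘ-injective (ℚᵘ.≃-trans unnormalised (ℚᵘ.≃-sym (toℚᵘ-homo‿- ⟦ x ⟧)))
  where
  unnormalised : toℚᵘ ⟦ -ℤ x ⟧ ≃ᵘ ℚᵘ.- toℚᵘ ⟦ x ⟧
  unnormalised rewrite ⟦⟧≡mkℚ (-ℤ x) | ⟦⟧≡mkℚ x = *≡* refl

⟦⟧-homo-− : ∀ x y → ⟦ x -ℤ y ⟧ ≡ ⟦ x ⟧ - ⟦ y ⟧
⟦⟧-homo-− x y = trans (⟦⟧-homo-+ x (-ℤ y)) (cong (λ w → ⟦ x ⟧ + w) (⟦⟧-homo-neg y))

⟦⟧-cassiniForm : ∀ u v → ⟦ cassiniForm u v ⟧ ≡ ⟦ v ⟧ * ⟦ v ⟧ - ⟦ u ⟧ * ⟦ v ⟧ - ⟦ u ⟧ * ⟦ u ⟧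
⟦⟧-cassiniForm u v = trans (⟦⟧-homo-− (v *ℤ v -ℤ u *ℤ v) (u *ℤ u))
  (cong₂ _-_ (trans (⟦⟧-homo-− (v *ℤ v) (u *ℤ v)) (cong₂ _-_ (⟦⟧-homo-* v v) (⟦⟧-homo-* u v))) (⟦⟧-homo-* u u))

⟦⟧-neg-÷ : ∀ z q → ⟦ -ℤ z ⟧ ÷ q ≡ - (⟦ z ⟧ ÷ q)
⟦⟧-neg-÷ z q = trans (cong (_* inv q) (⟦⟧-homo-neg z)) (sym (neg-distribˡ-* ⟦ z ⟧ (inv q)))

⟦⟧-≢0 : ∀ {z} → z ≢ 0ℤ → ⟦ z ⟧ ≢ 0ℚ
⟦⟧-≢0 {z} z≢0 ⟦z⟧≡0 = z≢0 (trans (cong ℚ.numerator (sym (⟦⟧≡mkℚ z))) (cong ℚ.numerator ⟦z⟧≡0))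

*-inv : ∀ q → q ≢ 0ℚ → q * inv q ≡ 1ℚ
*-inv q q≢0 with q ≟ 0ℚ
... | yes q≡0  = contradiction q≡0 q≢0
... | no  q≢0′ = *-inverseʳ q {{≢-nonZero q≢0′}}

inv-unique : ∀ p q → p * q ≡ 1ℚ → inv p ≡ q
inv-unique p q pq≡1 = begin
  inv p              ≡⟨ *-identityʳ (inv p) ⟨
  inv p * 1ℚ         ≡⟨ cong (inv p *_) pq≡1 ⟨
  inv p * (p * q)    ≡⟨ *-assoc (inv p) p q ⟨
  (inv p * p) * q    ≡⟨ cong (_* q) (trans (*-comm (inv p) p) (*-inv p p≢0)) ⟩
  1ℚ * q             ≡⟨ *-identityˡ q ⟩
  q                  ∎
  where
  p≢0 : p ≢ 0ℚ
  p≢0 refl with trans (sym (*-zeroˡ q)) pq≡1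
  ... | ()

÷-as-* : ∀ p q → p ÷ q ≡ p * (1ℚ ÷ q)
÷-as-* p q = cong (p *_) (sym (*-identityˡ (inv q)))

*-1÷ : ∀ q → q ≢ 0ℚ → q * (1ℚ ÷ q) ≡ 1ℚ
*-1÷ q q≢0 = trans (cong (q *_) (*-identityˡ (inv q))) (*-inv q q≢0)

onCircle-↑ : ∀ c x y → (x - c) * (x - c) + y * y ≡ ⟦ + 5 ⟧ * (half * half) → OnCircle c 0ℚ ρ (↑ x) (↑ y)
onCircle-↑ c x y h = cong₂ ⟨_,_⟩ (trans (real c x y) h) (imaginary c x y)
  where
  real : ∀ c x y → (x - c) * (x - c) + ⟦ + 5 ⟧ * ((0ℚ - 0ℚ) * (0ℚ - 0ℚ))
                     + ((y - 0ℚ) * (y - 0ℚ) + ⟦ + 5 ⟧ * ((0ℚ - 0ℚ) * (0ℚ - 0ℚ)))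
                   ≡ (x - c) * (x - c) + y * y
  real = RingSolver.solve-∀ ℚ-ring
  imaginary : ∀ c x y → (x - c) * (0ℚ - 0ℚ) + (0ℚ - 0ℚ) * (x - c) + ((y - 0ℚ) * (0ℚ - 0ℚ) + (0ℚ - 0ℚ) * (y - 0ℚ))
                        ≡ 0ℚ * half + half * 0ℚ
  imaginary = RingSolver.solve-∀ ℚ-ring

cassini-rescaled : ∀ A B y → B * y ≡ 1ℚ → B * B - A * B - A * A ≡ 1ℚ → (A * y) * (A * y) + A * y + y * y ≡ 1ℚ
cassini-rescaled A B y hy hC =
  ≡-modulo (- (y * y)) hC (≡-modulo (B * y + 1ℚ - A * y) hy (solve (A ∷ B ∷ y ∷ []) ℚ-ring))

onCircle-cassini : ∀ A B y k → B * y ≡ 1ℚ → B * B - A * B - A * A ≡ 1ℚ →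
                   OnCircle (k - half) 0ℚ ρ (↑ ((A + k * B) * y)) (↑ y)
onCircle-cassini A B y k hy hC = onCircle-↑ (k - half) ((A + k * B) * y) y
  (≡-modulo 1ℚ (cassini-rescaled A B y hy hC) (≡-modulo ((A * y + A * y + 1ℚ) * k + k * k * (B * y - 1ℚ)) hy
    (solve (A ∷ B ∷ y ∷ k ∷ []) ℚ-ring)))

-- Ford circles

radius-≡ : ∀ m iq → ⟦ m ⟧ * iq ≡ 1ℚ → radius m ≡ half * (iq * iq)
radius-≡ m iq h = inv-unique (⟦ + 2 ⟧ * (⟦ m ⟧ * ⟦ m ⟧)) (half * (iq * iq)) (inverse ⟦ m ⟧ iq h)
  where
  inverse : ∀ M iq → M * iq ≡ 1ℚ → (⟦ + 2 ⟧ * (M * M)) * (half * (iq * iq)) ≡ 1ℚ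
  inverse M iq h = ≡-modulo (M * iq + 1ℚ) h (solve (M ∷ iq ∷ []) ℚ-ring)

tangent-criterion : ∀ d r₁ r₂ → d * d ≡ (r₁ + r₁) * (r₂ + r₂) →
                    d * d + (r₁ - r₂) * (r₁ - r₂) ≡ (r₁ + r₂) * (r₁ + r₂)
tangent-criterion d r₁ r₂ h = ≡-modulo 1ℚ h (solve (d ∷ r₁ ∷ r₂ ∷ []) ℚ-ring)

onFordCircle-criterion : ∀ x y c r → (x - c) * (x - c) + y * y ≡ y * (r + r) →
                          (x - c) * (x - c) + (y - r) * (y - r) ≡ r * r
onFordCircle-criterion x y c r h = ≡-modulo 1ℚ h (solve (x ∷ y ∷ c ∷ r ∷ []) ℚ-ring)

tangency-distance : ∀ P Q R S iq is → Q * iq ≡ 1ℚ → S * is ≡ 1ℚ → (P * S - R * Q) * (P * S - R * Q) ≡ 1ℚ →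
  (P * iq - R * is) * (P * iq - R * is)
    ≡ (half * (iq * iq) + half * (iq * iq)) * (half * (is * is) + half * (is * is))
tangency-distance P Q R S iq is hQ hS hD = begin
  (P * iq - R * is) * (P * iq - R * is)                          ≡⟨ cong (λ d → d * d) cross ⟩
  ((P * S - R * Q) * (iq * is)) * ((P * S - R * Q) * (iq * is))
    ≡⟨ ≡-modulo ((iq * is) * (iq * is)) hD (solve (P ∷ Q ∷ R ∷ S ∷ iq ∷ is ∷ []) ℚ-ring) ⟩
  (half * (iq * iq) + half * (iq * iq)) * (half * (is * is) + half * (is * is)) ∎
  where
  cross : P * iq - R * is ≡ (P * S - R * Q) * (iq * is)
  cross = ≡-modulo (- (P * iq)) hS (≡-modulo (R * is) hQ (solve (P ∷ Q ∷ R ∷ S ∷ iq ∷ is ∷ []) ℚ-ring))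

tangencyPoint-onCircle : ∀ P Q R S iq t → Q * iq ≡ 1ℚ → (Q * Q + S * S) * t ≡ 1ℚ →
  (P * S - R * Q) * (P * S - R * Q) ≡ 1ℚ →
  ((P * Q + R * S) * t - P * iq) * ((P * Q + R * S) * t - P * iq) + t * t
    ≡ t * (half * (iq * iq) + half * (iq * iq))
tangencyPoint-onCircle P Q R S iq t hQ hN hD = begin
  ((P * Q + R * S) * t - P * iq) * ((P * Q + R * S) * t - P * iq) + t * t
    ≡⟨ cong (λ d → d * d + t * t) offset ⟩
  ((R * Q - P * S) * (S * iq * t)) * ((R * Q - P * S) * (S * iq * t)) + t * t
    ≡⟨ ≡-modulo ((S * iq * t) * (S * iq * t)) hD (solve (P ∷ Q ∷ R ∷ S ∷ iq ∷ t ∷ []) ℚ-ring) ⟩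
  (S * iq * t) * (S * iq * t) + t * t
    ≡⟨ ≡-modulo (t * (iq * iq)) hN (≡-modulo (- (t * t * (Q * iq + 1ℚ))) hQ
         (solve (P ∷ Q ∷ R ∷ S ∷ iq ∷ t ∷ []) ℚ-ring)) ⟩
  t * (half * (iq * iq) + half * (iq * iq)) ∎
  where
  offset : (P * Q + R * S) * t - P * iq ≡ (R * Q - P * S) * (S * iq * t)
  offset = ≡-modulo (- ((P * Q + R * S) * t)) hQ (≡-modulo (P * iq) hN (solve (P ∷ Q ∷ R ∷ S ∷ iq ∷ t ∷ []) ℚ-ring))

module _ (p q r s : ℤ) where

  private
    P = ⟦ p ⟧
    Q = ⟦ q ⟧
    R = ⟦ r ⟧
    S = ⟦ s ⟧
    N = q *ℤ q +ℤ s *ℤ s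

    ⟦D²⟧ : ⟦ (p *ℤ s -ℤ r *ℤ q) *ℤ (p *ℤ s -ℤ r *ℤ q) ⟧ ≡ (P * S - R * Q) * (P * S - R * Q)
    ⟦D²⟧ = trans (⟦⟧-homo-* (p *ℤ s -ℤ r *ℤ q) (p *ℤ s -ℤ r *ℤ q)) (cong (λ d → d * d) ⟦D⟧)
      where
      ⟦D⟧ : ⟦ p *ℤ s -ℤ r *ℤ q ⟧ ≡ P * S - R * Q
      ⟦D⟧ = trans (⟦⟧-homo-− (p *ℤ s) (r *ℤ q)) (cong₂ _-_ (⟦⟧-homo-* p s) (⟦⟧-homo-* r q))

    D²≡1 : (p *ℤ s -ℤ r *ℤ q) *ℤ (p *ℤ s -ℤ r *ℤ q) ≡ 1ℤ → (P * S - R * Q) * (P * S - R * Q) ≡ 1ℚ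
    D²≡1 hD = trans (sym ⟦D²⟧) (cong ⟦_⟧ hD)

    ⟦N⟧ : ⟦ N ⟧ ≡ Q * Q + S * S
    ⟦N⟧ = trans (⟦⟧-homo-+ (q *ℤ q) (s *ℤ s)) (cong₂ _+_ (⟦⟧-homo-* q q) (⟦⟧-homo-* s s))

    ⟦pq+rs⟧ : ⟦ p *ℤ q +ℤ r *ℤ s ⟧ ≡ P * Q + R * S
    ⟦pq+rs⟧ = trans (⟦⟧-homo-+ (p *ℤ q) (r *ℤ s)) (cong₂ _+_ (⟦⟧-homo-* p q) (⟦⟧-homo-* r s))

  onFord-tangencyPoint : (q≢0 : q ≢ 0ℤ) → (p *ℤ s -ℤ r *ℤ q) *ℤ (p *ℤ s -ℤ r *ℤ q) ≡ 1ℤ →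
    OnFord (K p q q≢0) (⟦ p *ℤ q +ℤ r *ℤ s ⟧ ÷ ⟦ N ⟧ , 1ℚ ÷ ⟦ N ⟧)
  onFord-tangencyPoint q≢0 hD =
    subst₂ (λ x ϱ → (x - P * inv Q) * (x - P * inv Q) + (t - ϱ) * (t - ϱ) ≡ ϱ * ϱ)
      (sym x≡) (sym (radius-≡ q (inv Q) hQ))
      (onFordCircle-criterion ((P * Q + R * S) * t) t (P * inv Q) (half * (inv Q * inv Q))
        (tangencyPoint-onCircle P Q R S (inv Q) t hQ hN (D²≡1 hD)))
    where
    t = 1ℚ ÷ ⟦ N ⟧
    hQ : Q * inv Q ≡ 1ℚ
    hQ = *-inv Q (⟦⟧-≢0 q≢0)
    hN : (Q * Q + S * S) * t ≡ 1ℚ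
    hN = trans (cong (_* t) (sym ⟦N⟧)) (*-1÷ ⟦ N ⟧ (⟦⟧-≢0 (sumOfSquares≢0 q s q≢0)))
    x≡ : ⟦ p *ℤ q +ℤ r *ℤ s ⟧ ÷ ⟦ N ⟧ ≡ (P * Q + R * S) * t
    x≡ = trans (÷-as-* ⟦ p *ℤ q +ℤ r *ℤ s ⟧ ⟦ N ⟧) (cong (_* t) ⟦pq+rs⟧)

  tangent-fordCircles : (q≢0 : q ≢ 0ℤ) (s≢0 : s ≢ 0ℤ) → (p *ℤ s -ℤ r *ℤ q) *ℤ (p *ℤ s -ℤ r *ℤ q) ≡ 1ℤ →
    Tangent (K p q q≢0) (K r s s≢0)
  tangent-fordCircles q≢0 s≢0 hD =
    subst₂ (λ ϱ₁ ϱ₂ → (P * inv Q - R * inv S) * (P * inv Q - R * inv S) + (ϱ₁ - ϱ₂) * (ϱ₁ - ϱ₂) ≡ (ϱ₁ + ϱ₂) * (ϱ₁ + ϱ₂))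
      (sym (radius-≡ q (inv Q) hQ)) (sym (radius-≡ s (inv S) hS))
      (tangent-criterion (P * inv Q - R * inv S) (half * (inv Q * inv Q)) (half * (inv S * inv S))
        (tangency-distance P Q R S (inv Q) (inv S) hQ hS (D²≡1 hD)))
    where
    hQ : Q * inv Q ≡ 1ℚ
    hQ = *-inv Q (⟦⟧-≢0 q≢0)
    hS : S * inv S ≡ 1ℚ
    hS = *-inv S (⟦⟧-≢0 s≢0)

fordTangency : ∀ p q r s (q≢0 : q ≢ 0ℤ) (s≢0 : s ≢ 0ℤ) → (p *ℤ s -ℤ r *ℤ q) *ℤ (p *ℤ s -ℤ r *ℤ q) ≡ 1ℤ →
  IsTangencyPoint (K p q q≢0) (K r s s≢0)
    (⟦ p *ℤ q +ℤ r *ℤ s ⟧ ÷ ⟦ q *ℤ q +ℤ s *ℤ s ⟧ , 1ℚ ÷ ⟦ q *ℤ q +ℤ s *ℤ s ⟧)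
fordTangency p q r s q≢0 s≢0 hD =
  tangent-fordCircles p q r s q≢0 s≢0 hD ,
  onFord-tangencyPoint p q r s q≢0 hD ,
  subst₂ (λ x n → OnFord (K r s s≢0) (⟦ x ⟧ ÷ ⟦ n ⟧ , 1ℚ ÷ ⟦ n ⟧))
    (ℤ.+-comm (r *ℤ s) (p *ℤ q)) (ℤ.+-comm (s *ℤ s) (q *ℤ q))
    (onFord-tangencyPoint r s p q s≢0 (trans (square-≡-neg (antisymmetric p q r s)) hD))
  where
  antisymmetric : ∀ p q r s → r *ℤ q -ℤ p *ℤ s ≡ -ℤ (p *ℤ s -ℤ r *ℤ q)
  antisymmetric = solve-∀

integerPoint-tangency : ∀ w → IsTangencyPoint (K w 1ℤ (λ ())) ∞ (⟦ w ⟧ ÷ ⟦ 1ℤ ⟧ , 1ℚ ÷ ⟦ 1ℤ ⟧)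
integerPoint-tangency w = refl , onFord ⟦ w ⟧ , refl
  where
  onFord : ∀ W → (W * inv ⟦ 1ℤ ⟧ - W * inv ⟦ 1ℤ ⟧) * (W * inv ⟦ 1ℤ ⟧ - W * inv ⟦ 1ℤ ⟧)
                   + (1ℚ * inv ⟦ 1ℤ ⟧ - radius 1ℤ) * (1ℚ * inv ⟦ 1ℤ ⟧ - radius 1ℤ)
                 ≡ radius 1ℤ * radius 1ℤ
  onFord = RingSolver.solve-∀ ℚ-ring

-- ((F₂ₙ + k F₂ₙ₊₁)/F₂ₙ₊₁, 1/F₂ₙ₊₁); k = 0, 1, 2, −1 give the points of (A)–(D).
oddPoint : ℤ → ℤ → Point
oddPoint n k = ⟦ F (+ 2 *ℤ n) +ℤ k *ℤ F (+ 2 *ℤ n +ℤ 1ℤ) ⟧ ÷ ⟦ F (+ 2 *ℤ n +ℤ 1ℤ) ⟧ , 1ℚ ÷ ⟦ F (+ 2 *ℤ n +ℤ 1ℤ) ⟧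

module _ (n : ℤ) where

  private
    u = F n
    v = F (n +ℤ 1ℤ)
    a = F (+ 2 *ℤ n)
    b = F (+ 2 *ℤ n +ℤ 1ℤ)

    a≡ : a ≡ u *ℤ (+ 2 *ℤ v -ℤ u)
    a≡ = cong proj₁ (F-doubling n)

    b≡ : b ≡ u *ℤ u +ℤ v *ℤ v
    b≡ = cong proj₂ (F-doubling n)

  F-odd≢0 : b ≢ 0ℤ
  F-odd≢0 b≡0 = neg-square≢1 a (begin
    -ℤ (a *ℤ a)       ≡⟨ cassiniForm-0ʳ a ⟨
    cassiniForm a 0ℤ  ≡⟨ cong (cassiniForm a) b≡0 ⟨
    cassiniForm a b   ≡⟨ cassiniAt-even n ⟩
    1ℤ                ∎)

  F-odd≡1 : u ≡ 0ℤ ⊎ v ≡ 0ℤ → b ≡ 1ℤ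
  F-odd≡1 u≡0⊎v≡0 = trans b≡ (sumOfSquares≡1 u v u≡0⊎v≡0 (cassiniAt² n))

  oddPoint-onCircle : ∀ k → OnCircle (⟦ k ⟧ - half) 0ℚ ρ (↑ (proj₁ (oddPoint n k))) (↑ (proj₂ (oddPoint n k)))
  oddPoint-onCircle k =
    subst (λ x → OnCircle (⟦ k ⟧ - half) 0ℚ ρ (↑ x) (↑ y)) (sym x≡)
      (onCircle-cassini ⟦ a ⟧ ⟦ b ⟧ y ⟦ k ⟧ (*-1÷ ⟦ b ⟧ (⟦⟧-≢0 F-odd≢0))
        (trans (sym (⟦⟧-cassiniForm a b)) (cong ⟦_⟧ (cassiniAt-even n))))
    where
    y = 1ℚ ÷ ⟦ b ⟧
    x≡ : proj₁ (oddPoint n k) ≡ (⟦ a ⟧ + ⟦ k ⟧ * ⟦ b ⟧) * y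
    x≡ = trans (÷-as-* ⟦ a +ℤ k *ℤ b ⟧ ⟦ b ⟧)
               (cong (_* y) (trans (⟦⟧-homo-+ a (k *ℤ b)) (cong (λ w → ⟦ a ⟧ + w) (⟦⟧-homo-* k b))))

  oddPoint-tangency-unit : b ≡ 1ℤ → ∀ k → FordTangencyPoint (oddPoint n k)
  oddPoint-tangency-unit b≡1 k = K w 1ℤ (λ ()) , ∞ ,
    subst (λ d → IsTangencyPoint (K w 1ℤ (λ ())) ∞ (⟦ w ⟧ ÷ ⟦ d ⟧ , 1ℚ ÷ ⟦ d ⟧)) (sym b≡1) (integerPoint-tangency w)
    where
    w = a +ℤ k *ℤ b

  oddPoint-tangency : ∀ k → FordTangencyPoint (oddPoint n k)
  oddPoint-tangency k with u ℤ.≟ 0ℤ | v ℤ.≟ 0ℤ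
  ... | yes u≡0 | _       = oddPoint-tangency-unit (F-odd≡1 (inj₁ u≡0)) k
  ... | no _    | yes v≡0 = oddPoint-tangency-unit (F-odd≡1 (inj₂ v≡0)) k
  ... | no u≢0  | no v≢0  =
    K p u u≢0 , K r v v≢0 , subst (IsTangencyPoint (K p u u≢0) (K r v v≢0)) point≡ (fordTangency p u r v u≢0 v≢0 D²≡1)
    where
    p = v -ℤ u +ℤ k *ℤ u
    r = u +ℤ k *ℤ v
    numerator : ∀ k u v → u *ℤ (+ 2 *ℤ v -ℤ u) +ℤ k *ℤ (u *ℤ u +ℤ v *ℤ v) ≡ (v -ℤ u +ℤ k *ℤ u) *ℤ u +ℤ (u +ℤ k *ℤ v) *ℤ v
    numerator = solve-∀
    point≡ : (⟦ p *ℤ u +ℤ r *ℤ v ⟧ ÷ ⟦ u *ℤ u +ℤ v *ℤ v ⟧ , 1ℚ ÷ ⟦ u *ℤ u +ℤ v *ℤ v ⟧) ≡ oddPoint n k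
    point≡ = cong₂ (λ w d → (⟦ w ⟧ ÷ ⟦ d ⟧ , 1ℚ ÷ ⟦ d ⟧))
      (sym (trans (cong₂ (λ a b → a +ℤ k *ℤ b) a≡ b≡) (numerator k u v))) (sym b≡)
    determinant : ∀ k u v → (v -ℤ u +ℤ k *ℤ u) *ℤ v -ℤ (u +ℤ k *ℤ v) *ℤ u ≡ v *ℤ v -ℤ u *ℤ v -ℤ u *ℤ u
    determinant = solve-∀
    D²≡1 : (p *ℤ v -ℤ r *ℤ u) *ℤ (p *ℤ v -ℤ r *ℤ u) ≡ 1ℤ
    D²≡1 = trans (cong (λ d → d *ℤ d) (determinant k u v)) (cassiniAt² n)

  oddPoint-x₀ : proj₁ (oddPoint n 0ℤ) ≡ ⟦ a ⟧ ÷ ⟦ b ⟧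
  oddPoint-x₀ = cong (λ w → ⟦ w ⟧ ÷ ⟦ b ⟧) (identity a b)
    where
    identity : ∀ a b → a +ℤ 0ℤ *ℤ b ≡ a
    identity = solve-∀

  oddPoint-x₁ : proj₁ (oddPoint n 1ℤ) ≡ ⟦ F (+ 2 *ℤ n +ℤ + 2) ⟧ ÷ ⟦ b ⟧
  oddPoint-x₁ = cong (λ w → ⟦ w ⟧ ÷ ⟦ b ⟧) (trans (identity a b) (sym (F-rec (+ 2 *ℤ n))))
    where
    identity : ∀ a b → a +ℤ 1ℤ *ℤ b ≡ b +ℤ a
    identity = solve-∀

  oddPoint-x₂ : proj₁ (oddPoint n (+ 2)) ≡ ⟦ F (+ 2 *ℤ n +ℤ + 3) ⟧ ÷ ⟦ b ⟧
  oddPoint-x₂ = cong (λ w → ⟦ w ⟧ ÷ ⟦ b ⟧) (begin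
    a +ℤ + 2 *ℤ b                   ≡⟨ identity a b ⟩
    (b +ℤ a) +ℤ b                   ≡⟨ cong (_+ℤ b) (F-rec (+ 2 *ℤ n)) ⟨
    F (+ 2 *ℤ n +ℤ + 2) +ℤ b        ≡⟨ F-rec-3 (+ 2 *ℤ n) ⟨
    F (+ 2 *ℤ n +ℤ + 3)             ∎)
    where
    identity : ∀ a b → a +ℤ + 2 *ℤ b ≡ (b +ℤ a) +ℤ b
    identity = solve-∀

  oddPoint-x₋₁ : proj₁ (oddPoint n -1ℤ) ≡ - (⟦ F (+ 2 *ℤ n -ℤ 1ℤ) ⟧ ÷ ⟦ b ⟧)
  oddPoint-x₋₁ = trans (cong (λ w → ⟦ w ⟧ ÷ ⟦ b ⟧) (trans (identity a b) (cong -ℤ_ (sym (F-rec-pred (+ 2 *ℤ n))))))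
                       (⟦⟧-neg-÷ (F (+ 2 *ℤ n -ℤ 1ℤ)) ⟦ b ⟧)
    where
    identity : ∀ a b → a +ℤ -1ℤ *ℤ b ≡ -ℤ (b -ℤ a)
    identity = solve-∀

mainTheorem3 :
  (∀ (n : ℤ) →
    -- (A) (F_{2n}/F_{2n+1}, 1/F_{2n+1}) on the circle centred (-1/2,0), radius √5/2
    OnCircle (- half) 0ℚ ρ (↑ (⟦ F (+ 2 *ℤ n) ⟧ ÷ ⟦ F (+ 2 *ℤ n +ℤ + 1) ⟧)) (↑ (1ℚ ÷ ⟦ F (+ 2 *ℤ n +ℤ + 1) ⟧))
    -- (B)
    × OnCircle half 0ℚ ρ (↑ (⟦ F (+ 2 *ℤ n +ℤ + 2) ⟧ ÷ ⟦ F (+ 2 *ℤ n +ℤ + 1) ⟧)) (↑ (1ℚ ÷ ⟦ F (+ 2 *ℤ n +ℤ + 1) ⟧))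
    -- (C)
    × OnCircle (⟦ + 3 ⟧ * half) 0ℚ ρ (↑ (⟦ F (+ 2 *ℤ n +ℤ + 3) ⟧ ÷ ⟦ F (+ 2 *ℤ n +ℤ + 1) ⟧)) (↑ (1ℚ ÷ ⟦ F (+ 2 *ℤ n +ℤ + 1) ⟧))
    -- (D)
    × OnCircle (- (⟦ + 3 ⟧ * half)) 0ℚ ρ (↑ (- (⟦ F (+ 2 *ℤ n -ℤ + 1) ⟧ ÷ ⟦ F (+ 2 *ℤ n +ℤ + 1) ⟧))) (↑ (1ℚ ÷ ⟦ F (+ 2 *ℤ n +ℤ + 1) ⟧))
    -- the points of (B), (C), (D) are points of tangency of two Ford circles
    × FordTangencyPoint (⟦ F (+ 2 *ℤ n +ℤ + 2) ⟧ ÷ ⟦ F (+ 2 *ℤ n +ℤ + 1) ⟧ , 1ℚ ÷ ⟦ F (+ 2 *ℤ n +ℤ + 1) ⟧)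
    × FordTangencyPoint (⟦ F (+ 2 *ℤ n +ℤ + 3) ⟧ ÷ ⟦ F (+ 2 *ℤ n +ℤ + 1) ⟧ , 1ℚ ÷ ⟦ F (+ 2 *ℤ n +ℤ + 1) ⟧)
    × FordTangencyPoint (- (⟦ F (+ 2 *ℤ n -ℤ + 1) ⟧ ÷ ⟦ F (+ 2 *ℤ n +ℤ + 1) ⟧) , 1ℚ ÷ ⟦ F (+ 2 *ℤ n +ℤ + 1) ⟧))
  -- x-axis intersections (two distinct points on each circle)
  × (OnCircle (- half) 0ℚ ρ (↑ 0ℚ ⊖ φ) (↑ 0ℚ) × OnCircle (- half) 0ℚ ρ τ (↑ 0ℚ) × (↑ 0ℚ ⊖ φ) ≢ τ)
  × (OnCircle half 0ℚ ρ (↑ 0ℚ ⊖ τ) (↑ 0ℚ) × OnCircle half 0ℚ ρ φ (↑ 0ℚ) × (↑ 0ℚ ⊖ τ) ≢ φ)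
  × (OnCircle (⟦ + 3 ⟧ * half) 0ℚ ρ (τ ⊗ τ) (↑ 0ℚ) × OnCircle (⟦ + 3 ⟧ * half) 0ℚ ρ (φ ⊗ φ) (↑ 0ℚ) × (τ ⊗ τ) ≢ (φ ⊗ φ))
  × (OnCircle (- (⟦ + 3 ⟧ * half)) 0ℚ ρ (↑ 0ℚ ⊖ φ ⊗ φ) (↑ 0ℚ) × OnCircle (- (⟦ + 3 ⟧ * half)) 0ℚ ρ (↑ 0ℚ ⊖ τ ⊗ τ) (↑ 0ℚ) × (↑ 0ℚ ⊖ φ ⊗ φ) ≢ (↑ 0ℚ ⊖ τ ⊗ τ))
mainTheorem3 =
    (λ n → circle n 0ℤ (oddPoint-x₀ n) , circle n 1ℤ (oddPoint-x₁ n) , circle n (+ 2) (oddPoint-x₂ n)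
         , circle n -1ℤ (oddPoint-x₋₁ n)
         , tangency n 1ℤ (oddPoint-x₁ n) , tangency n (+ 2) (oddPoint-x₂ n) , tangency n -1ℤ (oddPoint-x₋₁ n))
  , (refl , refl , λ ()) , (refl , refl , λ ()) , (refl , refl , λ ()) , (refl , refl , λ ())
  where
  circle : ∀ n k {x} → proj₁ (oddPoint n k) ≡ x → OnCircle (⟦ k ⟧ - half) 0ℚ ρ (↑ x) (↑ (proj₂ (oddPoint n k)))
  circle n k refl = oddPoint-onCircle n k
  tangency : ∀ n k {x} → proj₁ (oddPoint n k) ≡ x → FordTangencyPoint (x , proj₂ (oddPoint n k))
  tangency n k refl = oddPoint-tangency n k
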